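{- Let $G=(X,Y,E)$ be a chained complete bipartite graph with MCB-component family $\mathscr{C}=\{C_1,\dots,C_n\}$ labelled as in the definition, with overlapping vertices $s_i\in C_i\cap C_{i+1}$ ($1\le i\le n-1$). For every $C_i\in\mathscr{C}$: if $|X_i|=1$ then $s_{i-1}\notin X_i$ and $s_i\notin X_i$; and if $|Y_i|=1$ then $s_{i-1}\notin Y_i$ and $s_i\notin Y_i$ (for those of $s_{i-1},s_i$ that exist).
   Context: All graphs are finite, simple, undirected and connected. For a graph $G=(V,E)$, a family of MCB-components (maximal complete bipartite components) is a family $\mathscr{C}$ of subsets of $V$ such that (i) every edge has both endpoints in some $C\in\mathscr{C}$, (ii) each $G[C]$, $C\in\mathscr{C}$, is a complete bipartite graph, and (iii) for each $C\in\mathscr{C}$ and $v\in V\setminus C$, $G[C\cup\{v\}]$ is not a complete bipartite graph. A bipartite graph $G=(X,Y,E)$ is a chained complete bipartite graph if it has an MCB-component family that can be labelled $\mathscr{C}=\{C_1,\dots,C_n\}$ so that $|C_i\cap C_{i+1}|=1$ for $1\le i<n$ and $C_i\cap C_j=\emptyset$ whenever $|i-j|>1$. The unique vertex of $C_i\cap C_{i+1}$ is called an overlapping vertex and denoted $s_i$. We write $G[C_i]=(X_i,Y_i,E_i)$ with $X_i=X\cap C_i$, $Y_i=Y\cap C_i$. -}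

module Defs where

open import Data.Nat using (ℕ; suc; _+_; _≤_)
open import Data.Fin using (Fin; toℕ)
open import Data.Fin.Subset using (Subset; _∈_; _∉_; _∩_; _∪_; ⁅_⁆; ∣_∣; Nonempty; Empty)
open import Data.Bool using (Bool; true)
open import Data.Product using (Σ; ∃; _×_)
open import Data.Sum using (_⊎_)
open import Relation.Nullary using (¬_)
open import Relation.Binary.PropositionalEquality using (_≡_)
open import Function.Definitions using (Injective)

data Walk {m : ℕ} (adj : Fin m → Fin m → Bool) : Fin m → Fin m → Set where
  here : ∀ {u} → Walk adj u u
  step : ∀ {u w v} → adj u w ≡ true → Walk adj w v → Walk adj u v

record Graph (m : ℕ) : Set where
  field
    adj       : Fin m → Fin m → Bool
    symmetric : ∀ u v → adj u v ≡ adj v u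
    irreflex  : ∀ u → ¬ (adj u u ≡ true)
    connected : ∀ u v → Walk adj u v

  E : Fin m → Fin m → Set
  E u v = adj u v ≡ true

open Graph public

-- G = (X, Y, E) is bipartite with parts X and Y = complement of X.
IsBipartition : ∀ {m} → Graph m → Subset m → Set
IsBipartition G X = ∀ u v → E G u v → (u ∈ X × v ∉ X) ⊎ (u ∉ X × v ∈ X)

IsCompleteBipartite : ∀ {m} → Graph m → Subset m → Set
IsCompleteBipartite {m} G C =
  Σ (Subset m) λ A → Σ (Subset m) λ B →
      (∀ v → v ∈ C → v ∈ A ⊎ v ∈ B)
    × (∀ v → v ∈ A → v ∈ C)
    × (∀ v → v ∈ B → v ∈ C)
    × Empty (A ∩ B)
    × Nonempty A
    × Nonempty B
    × (∀ a b → a ∈ A → b ∈ B → E G a b)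
    × (∀ a a' → a ∈ A → a' ∈ A → ¬ E G a a')
    × (∀ b b' → b ∈ B → b' ∈ B → ¬ E G b b')

-- A (labelled) family of MCB-components C₁,…,Cₙ (labels injective, since the family is a set).
IsMCBFamily : ∀ {m n} → Graph m → (Fin n → Subset m) → Set
IsMCBFamily {m} {n} G C =
    Injective _≡_ _≡_ C
  × (∀ u v → E G u v → ∃ λ i → u ∈ C i × v ∈ C i)
  × (∀ i → IsCompleteBipartite G (C i))
  × (∀ i v → v ∉ C i → ¬ IsCompleteBipartite G (⁅ v ⁆ ∪ C i))

IsChained : ∀ {m n} → (Fin n → Subset m) → Set
IsChained {m} {n} C =
    (∀ j k → suc (toℕ j) ≡ toℕ k → ∣ C j ∩ C k ∣ ≡ 1)
  × (∀ j k → (toℕ j + 2 ≤ toℕ k ⊎ toℕ k + 2 ≤ toℕ j) → Empty (C j ∩ C k))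

-- Let s be an overlapping vertex of Cᵢ and suppose s ∈ Xᵢ with |Xᵢ| = 1. Since G is
-- bipartite, Xᵢ is exactly the part of G[Cᵢ] containing s, so that part is {s}. As s
-- also lies in the neighbouring component C', it has a neighbour y in C', and y ∉ Cᵢ
-- because Cᵢ ∩ C' = {s}. Bipartite graphs are triangle-free, so y has no neighbour in
-- the other part of G[Cᵢ]; hence G[Cᵢ ∪ {y}] is complete bipartite with parts {s} and
-- Yᵢ ∪ {y}, contradicting the maximality of Cᵢ. The case |Yᵢ| = 1 is symmetric.
module Submission where

open import Defs
open import Data.Nat using (ℕ; suc; _<_)
open import Data.Nat.Properties using (<-irrefl)
open import Data.Fin using (Fin; toℕ; _≟_)
open import Data.Fin.Subset using (Subset; _∈_; _∉_; _⊆_; _⊂_; _∩_; _∪_; ⁅_⁆; ∁; ∣_∣)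
open import Data.Fin.Subset.Properties
  using ( _∈?_; p⊂q⇒∣p∣<∣q∣; ∣⁅x⁆∣≡1; x∈⁅x⁆; x∈⁅y⁆⇒x≡y; x∈p∩q⁺; x∈p∩q⁻; x∈p∪q⁺; x∈p∪q⁻
        ; ∩-comm; x∈p⇒x∉∁p; x∉p⇒x∈∁p)
open import Data.Product using (_×_; _,_; proj₁; proj₂; ∃) renaming (swap to ×-swap)
open import Data.Sum using (_⊎_; inj₁; inj₂)
import Data.Sum as Sum
open import Data.Empty using (⊥; ⊥-elim)
open import Function using (_∘_; _∘₂_)
open import Relation.Nullary using (¬_; yes; no; contradiction)
open import Relation.Binary.PropositionalEquality
  using (_≡_; _≢_; refl; sym; trans; subst; subst₂; cong)

private
  variable
    n : ℕ

∣p∣≡1⇒∈-unique : ∀ {p : Subset n} {x y} → ∣ p ∣ ≡ 1 → x ∈ p → y ∈ p → y ≡ x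
∣p∣≡1⇒∈-unique {p = p} {x} {y} ∣p∣≡1 x∈p y∈p with y ≟ x
... | yes y≡x = y≡x
... | no  y≢x = ⊥-elim (<-irrefl refl (subst₂ _<_ (∣⁅x⁆∣≡1 x) ∣p∣≡1 (p⊂q⇒∣p∣<∣q∣ ⁅x⁆⊂p)))
  where
  ⁅x⁆⊂p : ⁅ x ⁆ ⊂ p
  ⁅x⁆⊂p = (λ z∈⁅x⁆ → subst (_∈ p) (sym (x∈⁅y⁆⇒x≡y x z∈⁅x⁆)) x∈p)
        , y , y∈p , y≢x ∘ x∈⁅y⁆⇒x≡y x

x∈⁅y⁆∪p⁻ : ∀ {x y : Fin n} p → x ∈ ⁅ y ⁆ ∪ p → x ≡ y ⊎ x ∈ p
x∈⁅y⁆∪p⁻ p = Sum.map₁ (x∈⁅y⁆⇒x≡y _) ∘ x∈p∪q⁻ ⁅ _ ⁆ p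

module _ {m : ℕ} {G : Graph m} where

  private
    variable
      u v w a a' b s y : Fin m
      Z C : Subset m

  E-sym : E G u v → E G v u
  E-sym {u} {v} = trans (symmetric G v u)

  E⇒≢ : E G u v → u ≢ v
  E⇒≢ {u} uv refl = irreflex G u uv

  IsBipartition-∁ : IsBipartition G Z → IsBipartition G (∁ Z)
  IsBipartition-∁ bip u v uv with bip u v uv
  ... | inj₁ (u∈Z , v∉Z) = inj₂ (x∈p⇒x∉∁p u∈Z , x∉p⇒x∈∁p v∉Z)
  ... | inj₂ (u∉Z , v∈Z) = inj₁ (x∉p⇒x∈∁p u∉Z , x∈p⇒x∉∁p v∈Z)

  module _ (bip : IsBipartition G Z) where

    ∈-edge-∉ : E G u v → u ∈ Z → v ∉ Z
    ∈-edge-∉ {u} {v} uv u∈Z with bip u v uv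
    ... | inj₁ (_ , v∉Z) = v∉Z
    ... | inj₂ (u∉Z , _) = contradiction u∈Z u∉Z

    ∉-edge-∈ : E G u v → u ∉ Z → v ∈ Z
    ∉-edge-∈ {u} {v} uv u∉Z with bip u v uv
    ... | inj₁ (u∈Z , _) = contradiction u∈Z u∉Z
    ... | inj₂ (_ , v∈Z) = v∈Z

    common-neighbour-same-side : E G a b → E G a' b → a ∈ Z → a' ∈ Z
    common-neighbour-same-side {a' = a'} ab a'b a∈Z with a' ∈? Z
    ... | yes a'∈Z = a'∈Z
    ... | no  a'∉Z = contradiction (∉-edge-∈ a'b a'∉Z) (∈-edge-∉ ab a∈Z)

    bipartite⇒triangle-free : E G u v → E G v w → E G u w → ⊥
    bipartite⇒triangle-free {u} uv vw uw with u ∈? Z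
    ... | yes u∈Z = ∈-edge-∉ uw u∈Z (∉-edge-∈ vw (∈-edge-∉ uv u∈Z))
    ... | no  u∉Z = ∈-edge-∉ vw (∉-edge-∈ uv u∉Z) (∉-edge-∈ uw u∉Z)

  IsCompleteBipartite-swap : IsCompleteBipartite G C → IsCompleteBipartite G C
  IsCompleteBipartite-swap
    (A , B , cover , A⊆C , B⊆C , A∩B=∅ , A≠∅ , B≠∅ , complete , A-indep , B-indep) =
    B , A , Sum.swap ∘₂ cover , B⊆C , A⊆C
      , (λ (v , v∈B∩A) → A∩B=∅ (v , x∈p∩q⁺ (×-swap (x∈p∩q⁻ B A v∈B∩A))))
      , B≠∅ , A≠∅ , (λ b a b∈B a∈A → E-sym (complete a b a∈A b∈B)) , B-indep , A-indep

  orient : (cb : IsCompleteBipartite G C) → s ∈ C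
         → ∃ λ (cb' : IsCompleteBipartite G C) → s ∈ proj₁ cb'
  orient {s = s} cb s∈C with proj₁ (proj₂ (proj₂ cb)) s s∈C
  ... | inj₁ s∈A = cb , s∈A
  ... | inj₂ s∈B = IsCompleteBipartite-swap cb , s∈B

  has-neighbour : IsCompleteBipartite G C → s ∈ C → ∃ λ y → y ∈ C × E G s y
  has-neighbour (A , B , cover , A⊆C , B⊆C , _ , (a , a∈A) , (b , b∈B) , complete , _) s∈C
    with cover _ s∈C
  ... | inj₁ s∈A = b , B⊆C b b∈B , complete _ b s∈A b∈B
  ... | inj₂ s∈B = a , A⊆C a a∈A , E-sym (complete a _ a∈A s∈B)

  singleton-part : IsBipartition G Z → (cb : IsCompleteBipartite G C)
                 → ∣ Z ∩ C ∣ ≡ 1 → s ∈ Z → s ∈ proj₁ cb → proj₁ cb ⊆ ⁅ s ⁆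
  singleton-part {Z = Z} bip (A , B , _ , A⊆C , _ , _ , _ , (b , b∈B) , complete , _)
                 ∣Z∩C∣≡1 s∈Z s∈A {a} a∈A =
    subst (_∈ ⁅ _ ⁆) (sym a≡s) (x∈⁅x⁆ _)
    where
    a∈Z : a ∈ Z
    a∈Z = common-neighbour-same-side bip (complete _ b s∈A b∈B) (complete a b a∈A b∈B) s∈Z
    a≡s = ∣p∣≡1⇒∈-unique ∣Z∩C∣≡1 (x∈p∩q⁺ (s∈Z , A⊆C _ s∈A)) (x∈p∩q⁺ (a∈Z , A⊆C a a∈A))

  -- A star stays complete bipartite when a new leaf is attached to its centre: since the
  -- graph is triangle-free, the new leaf is adjacent to none of the old ones.
  add-leaf : IsBipartition G Z → (cb : IsCompleteBipartite G C) → proj₁ cb ⊆ ⁅ s ⁆ → E G s y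
           → IsCompleteBipartite G (⁅ y ⁆ ∪ C)
  add-leaf {C = C} {s = s} {y = y} bip
           (A , B , cover , A⊆C , B⊆C , A∩B=∅ , A≠∅ , _ , complete , A-indep , B-indep) A⊆⁅s⁆ sy =
      A , ⁅ y ⁆ ∪ B
    , (λ v v∈yC → cover′ (x∈⁅y⁆∪p⁻ C v∈yC))
    , (λ v v∈A → x∈p∪q⁺ (inj₂ (A⊆C v v∈A)))
    , (λ v v∈yB → x∈p∪q⁺ (Sum.map₂ (B⊆C v) (x∈p∪q⁻ ⁅ y ⁆ B v∈yB)))
    , (λ (v , v∈A∩yB) → disjoint (x∈p∩q⁻ A (⁅ y ⁆ ∪ B) v∈A∩yB))
    , A≠∅ , (y , x∈p∪q⁺ (inj₁ (x∈⁅x⁆ y)))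
    , (λ a b a∈A b∈yB → complete′ a∈A (x∈⁅y⁆∪p⁻ B b∈yB))
    , A-indep
    , (λ b b′ b∈yB b′∈yB → indep′ (x∈⁅y⁆∪p⁻ B b∈yB) (x∈⁅y⁆∪p⁻ B b′∈yB))
    where
    ≡s : ∀ {a} → a ∈ A → a ≡ s
    ≡s = x∈⁅y⁆⇒x≡y s ∘ A⊆⁅s⁆

    y-B-nonadjacent : b ∈ B → ¬ E G y b
    y-B-nonadjacent b∈B yb = bipartite⇒triangle-free bip sy yb sb
      where
      sb = subst (λ a → E G a _) (≡s (proj₂ A≠∅)) (complete _ _ (proj₂ A≠∅) b∈B)

    cover′ : v ≡ y ⊎ v ∈ C → v ∈ A ⊎ v ∈ ⁅ y ⁆ ∪ B
    cover′ (inj₁ refl) = inj₂ (x∈p∪q⁺ (inj₁ (x∈⁅x⁆ _)))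
    cover′ (inj₂ v∈C)  = Sum.map₂ (x∈p∪q⁺ ∘ inj₂) (cover _ v∈C)

    disjoint : v ∈ A × v ∈ ⁅ y ⁆ ∪ B → ⊥
    disjoint (v∈A , v∈yB) with x∈⁅y⁆∪p⁻ B v∈yB
    ... | inj₁ refl = E⇒≢ sy (sym (≡s v∈A))
    ... | inj₂ v∈B  = A∩B=∅ (_ , x∈p∩q⁺ (v∈A , v∈B))

    complete′ : a ∈ A → b ≡ y ⊎ b ∈ B → E G a b
    complete′ a∈A (inj₁ refl) rewrite ≡s a∈A = sy
    complete′ a∈A (inj₂ b∈B)  = complete _ _ a∈A b∈B

    indep′ : b ≡ y ⊎ b ∈ B → a ≡ y ⊎ a ∈ B → ¬ E G b a
    indep′ (inj₁ refl) (inj₁ refl) = irreflex G y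
    indep′ (inj₁ refl) (inj₂ a∈B)  = y-B-nonadjacent a∈B
    indep′ (inj₂ b∈B)  (inj₁ refl) = y-B-nonadjacent b∈B ∘ E-sym
    indep′ (inj₂ b∈B)  (inj₂ a∈B)  = B-indep _ _ b∈B a∈B

  neighbours-of-singleton-side : IsBipartition G Z → IsCompleteBipartite G C
    → (∀ v → v ∉ C → ¬ IsCompleteBipartite G (⁅ v ⁆ ∪ C))
    → ∣ Z ∩ C ∣ ≡ 1 → s ∈ Z → s ∈ C → E G s y → y ∈ C
  neighbours-of-singleton-side {C = C} {y = y} bip cb maximal ∣Z∩C∣≡1 s∈Z s∈C sy with y ∈? C
  ... | yes y∈C = y∈C
  ... | no  y∉C = ⊥-elim (maximal y y∉C (add-leaf bip cb′ A⊆⁅s⁆ sy))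
    where
    cb′ = proj₁ (orient cb s∈C)
    s∈A = proj₂ (orient cb s∈C)
    A⊆⁅s⁆ = singleton-part bip cb′ ∣Z∩C∣≡1 s∈Z s∈A

  overlap∉singleton-side : ∀ {n} {C : Fin n → Subset m} → IsBipartition G Z → IsMCBFamily G C
    → ∀ i l → ∣ C i ∩ C l ∣ ≡ 1 → ∣ Z ∩ C i ∣ ≡ 1 → s ∈ C i → s ∈ C l → s ∉ Z
  overlap∉singleton-side bip (_ , _ , complete-bipartite , maximal) i l
                         ∣Cᵢ∩Cₗ∣≡1 ∣Z∩Cᵢ∣≡1 s∈Cᵢ s∈Cₗ s∈Z =
    E⇒≢ sy (sym y≡s)
    where
    y∈Cₗ,sy = proj₂ (has-neighbour (complete-bipartite l) s∈Cₗ)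
    sy = proj₂ y∈Cₗ,sy
    y∈Cᵢ = neighbours-of-singleton-side bip (complete-bipartite i) (maximal i)
                                         ∣Z∩Cᵢ∣≡1 s∈Z s∈Cᵢ sy
    y≡s = ∣p∣≡1⇒∈-unique ∣Cᵢ∩Cₗ∣≡1 (x∈p∩q⁺ (s∈Cᵢ , s∈Cₗ)) (x∈p∩q⁺ (y∈Cᵢ , proj₁ y∈Cₗ,sy))

  chained-overlap∉singleton-side : ∀ {n} {C : Fin n → Subset m}
    → IsBipartition G Z → IsMCBFamily G C → IsChained C
    → ∀ i → ∣ Z ∩ C i ∣ ≡ 1
    → ∀ j k s → suc (toℕ j) ≡ toℕ k → (j ≡ i ⊎ k ≡ i)
    → s ∈ C j → s ∈ C k → s ∉ Z ∩ C i
  chained-overlap∉singleton-side {Z = Z} {C = C} bip fam (meet , _) i ∣Z∩Cᵢ∣≡1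
                                 j k s j+1≡k i∈jk s∈Cⱼ s∈Cₖ s∈Z∩Cᵢ with i∈jk
  ... | inj₁ refl = overlap∉singleton-side bip fam j k (meet j k j+1≡k) ∣Z∩Cᵢ∣≡1 s∈Cⱼ s∈Cₖ s∈Z
    where s∈Z = proj₁ (x∈p∩q⁻ Z (C j) s∈Z∩Cᵢ)
  ... | inj₂ refl = overlap∉singleton-side bip fam k j ∣Cₖ∩Cⱼ∣≡1 ∣Z∩Cᵢ∣≡1 s∈Cₖ s∈Cⱼ s∈Z
    where
    s∈Z = proj₁ (x∈p∩q⁻ Z (C k) s∈Z∩Cᵢ)
    ∣Cₖ∩Cⱼ∣≡1 = trans (cong ∣_∣ (∩-comm (C k) (C j))) (meet j k j+1≡k)

lemma4 : ∀ {m n} (G : Graph m) (X : Subset m) (C : Fin n → Subset m)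
    → IsBipartition G X → IsMCBFamily G C → IsChained C
    → ∀ (i : Fin n)
    → (∣ X ∩ C i ∣ ≡ 1
        → ∀ (j k : Fin n) (s : Fin m) → suc (toℕ j) ≡ toℕ k → (j ≡ i ⊎ k ≡ i)
        → s ∈ C j → s ∈ C k → s ∉ X ∩ C i)
    × (∣ ∁ X ∩ C i ∣ ≡ 1
        → ∀ (j k : Fin n) (s : Fin m) → suc (toℕ j) ≡ toℕ k → (j ≡ i ⊎ k ≡ i)
        → s ∈ C j → s ∈ C k → s ∉ ∁ X ∩ C i)
lemma4 G X C bip fam chained i =
    chained-overlap∉singleton-side {G = G} bip fam chained i
  , chained-overlap∉singleton-side {G = G} (IsBipartition-∁ {G = G} bip) fam chained i
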